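{- Let $G$ be a finite simple $d$-regular Vizing-class-2 graph with resistance $r(G)=1$. If $G$ admits a proper edge coloring $c:E(G)\rightarrow\{1,2,\dots,d+1\}$ such that $c^{ -1}(d+1)=\{e\}$ for some edge $e$ that is not contained in any $3$-cycle of $G$, then $\eta'_p(G)\leq 2d$.
   Context: A $d$-regular graph is Vizing-class-2 if its chromatic index equals $d+1$. The resistance $r(G)$ of a $d$-regular Vizing-class-2 graph is $\min\{|c^{ -1}(d+1)|: c \text{ a proper } (d+1)\text{ -edge-coloring } c:E(G)\to\{1,\dots,d+1\}\}$. For an edge $e$, $N'(e)$ is the set of edges other than $e$ sharing an endpoint with $e$. $\eta_p'(G)$ is the least $k$ such that there is a proper edge coloring $c:E(G)\to\{1,\dots,k\}$ with $\sum_{e\in N'(e_1)}c(e)\neq\sum_{e\in N'(e_2)}c(e)$ for every two edges $e_1,e_2$ sharing an endpoint. -}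

module Defs where

open import Data.Nat using (ℕ; zero; suc; _+_; _*_; _≤_; _<_)
open import Data.Fin using (Fin) renaming (_<_ to _<ᶠ_)
open import Data.Fin.Properties using (_≟_)
open import Data.Bool using (Bool; true; false; if_then_else_; _∧_)
open import Data.List using (List; map; allFin)
open import Data.Nat.ListAction using (sum)
open import Data.Product using (Σ; _×_; _,_; ∃-syntax)
open import Data.Sum using (_⊎_)
open import Relation.Nullary using (¬_; Dec; yes; no)
open import Relation.Binary.PropositionalEquality using (_≡_; _≢_)
open import Data.Nat.Properties using () renaming (_≟_ to _≟ℕ_)
open import Relation.Nullary.Decidable using (⌊_⌋)

record Graph : Set where
  field
    n      : ℕ
    adj    : Fin n → Fin n → Bool
    sym    : ∀ u v → adj u v ≡ adj v u
    irrefl : ∀ v → adj v v ≡ false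

open Graph public

Adj : (G : Graph) → Fin (n G) → Fin (n G) → Set
Adj G u v = adj G u v ≡ true

degree : (G : Graph) → Fin (n G) → ℕ
degree G v = sum (map (λ w → if adj G v w then 1 else 0) (allFin (n G)))

Regular : Graph → ℕ → Set
Regular G d = ∀ v → degree G v ≡ d

-- An edge coloring: a function on vertex pairs, only its values on
-- adjacent pairs matter; the color of edge uv is c u v = c v u.
EdgeCol : Graph → Set
EdgeCol G = Fin (n G) → Fin (n G) → ℕ

ProperColoring : (G : Graph) → ℕ → EdgeCol G → Set
ProperColoring G k c =
  (∀ u v → Adj G u v → c u v ≡ c v u) ×
  (∀ u v → Adj G u v → 1 ≤ c u v × c u v ≤ k) ×
  (∀ u v w → Adj G u v → Adj G u w → v ≢ w → c u v ≢ c u w)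

HasProperColoring : Graph → ℕ → Set
HasProperColoring G k = Σ (EdgeCol G) (ProperColoring G k)

IsChromaticIndex : Graph → ℕ → Set
IsChromaticIndex G k = HasProperColoring G k × (∀ j → HasProperColoring G j → k ≤ j)

VizingClass2 : Graph → ℕ → Set
VizingClass2 G d = Regular G d × IsChromaticIndex G (suc d)

colorCount : (G : Graph) → EdgeCol G → ℕ → ℕ
colorCount G c a =
  sum (map (λ u → sum (map (λ v →
    if adj G u v ∧ ⌊ Data.Fin._<?_ u v ⌋ ∧ ⌊ c u v ≟ℕ a ⌋ then 1 else 0)
    (allFin (n G)))) (allFin (n G)))

IsResistance : (G : Graph) → (d : ℕ) → ℕ → Set
IsResistance G d r =
  (Σ (EdgeCol G) λ c → ProperColoring G (suc d) c × colorCount G c (suc d) ≡ r) ×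
  (∀ c → ProperColoring G (suc d) c → r ≤ colorCount G c (suc d))

NotInTriangle : (G : Graph) → Fin (n G) → Fin (n G) → Set
NotInTriangle G u v = ∀ w → ¬ (Adj G u w × Adj G v w)

partialSum : (G : Graph) → EdgeCol G → Fin (n G) → Fin (n G) → ℕ
partialSum G c u v =
  sum (map (λ w → if adj G u w ∧ Data.Bool.not ⌊ w ≟ v ⌋ then c u w else 0) (allFin (n G)))

nbSum : (G : Graph) → EdgeCol G → Fin (n G) → Fin (n G) → ℕ
nbSum G c u v = partialSum G c u v + partialSum G c v u

NSDColoring : (G : Graph) → ℕ → EdgeCol G → Set
NSDColoring G k c =
  ProperColoring G k c ×
  (∀ u v w → Adj G u v → Adj G u w → v ≢ w → nbSum G c u v ≢ nbSum G c u w)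

HasNSDColoring : Graph → ℕ → Set
HasNSDColoring G k = Σ (EdgeCol G) (NSDColoring G k)

IsEtaP : Graph → ℕ → Set
IsEtaP G k = HasNSDColoring G k × (∀ j → HasNSDColoring G j → k ≤ j)

-- Let c be the given colouring, with colour d + 1 only on uv. Every vertex other than u and v
-- sees all of the colours 1 … d, while u and v each miss exactly one of them, and not the same
-- one: otherwise uv could be recoloured with it, giving a d-edge-colouring. Each colour class is a
-- matching, so the number of vertices missing a colour j has the parity of |V|; summing over j
-- gives d · (|V| mod 2) = 2, hence d = 2.
--
-- So G is 2-regular and c uses colour 3 only on uv. For edges xy and xw the neighbour sums are
-- c(xw) + c(yy′) and c(xy) + c(ww′), where y′ and w′ are the other neighbours of y and w. Keep
-- colour 1, give uv colour 2 and give colour 3 to the colour-2 edges with an end adjacent to u or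
-- v. Away from uv the colours along y′ y x w w′ alternate between 1 and {2, 3}, so one sum is 2
-- and the other at least 4; the paths through uv are checked case by case, using that the two
-- edges next to uv have different colours and that uv lies in no triangle. This 3-edge-colouring
-- shows η′_p(G) = 3 ≤ 2d.

module Submission where

open import Defs hiding (sym)

open import Data.Nat using (ℕ; zero; suc; _+_; _*_; _∸_; _≤_; _<_; z≤n; s≤s; _%_)
open import Data.Nat.DivMod using ([m+kn]%n≡m%n; m<n⇒m%n≡m; m%n<n)
open import Data.Nat.Properties
open import Data.Fin using (Fin; zero; suc; toℕ; fromℕ; fromℕ<; inject₁)
import Data.Fin.Properties as Fin
open import Data.Bool using (Bool; true; false; if_then_else_; _∧_; _∨_; not)
open import Data.Bool.Properties using (∨-comm; ¬-not) renaming (_≟_ to _≟ᵇ_)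
open import Data.List using (map; allFin; tabulate)
import Data.List.Properties as List
import Data.Nat.ListAction as List
open import Data.Product using (Σ; _×_; _,_; ∃; ∃-syntax; proj₁; proj₂)
open import Data.Sum using (_⊎_; inj₁; inj₂; [_,_]′)
open import Function using (_∘_; id)
open import Data.Nat.Divisibility using (_∣_; divides; ∣m∣n⇒∣m+n; m∣m*n)
open import Relation.Nullary using (yes; no)
open import Data.Empty using (⊥; ⊥-elim)
open import Relation.Nullary.Decidable using (⌊_⌋)
open import Relation.Binary.PropositionalEquality
open import Algebra.Properties.CommutativeMonoid.Sum +-0-commutativeMonoid
  using (sum-syntax; sum-cong-≗; sum-replicate-zero; ∑-distrib-+; ∑-comm; sum-init-last)

private variable m : ℕ

-- Finite sums

sum-tabulate : (f : Fin m → ℕ) → List.sum (tabulate f) ≡ ∑[ i < m ] f i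
sum-tabulate {zero} f = refl
sum-tabulate {suc m} f = cong (f zero +_) (sum-tabulate (f ∘ suc))

sum-map-allFin : (f : Fin m → ℕ) → List.sum (map f (allFin m)) ≡ ∑[ i < m ] f i
sum-map-allFin f = trans (cong List.sum (List.map-tabulate id f)) (sum-tabulate f)

∑-const : ∀ m k → ∑[ i < m ] k ≡ m * k
∑-const zero k = refl
∑-const (suc m) k = cong (k +_) (∑-const m k)

∑-zero : (f : Fin m → ℕ) → (∀ i → f i ≡ 0) → ∑[ i < m ] f i ≡ 0
∑-zero {m} f f≡0 = trans (sum-cong-≗ f≡0) (sum-replicate-zero m)

≤-∑ : (f : Fin m → ℕ) (i : Fin m) → f i ≤ ∑[ j < m ] f j
≤-∑ f zero = m≤m+n _ _
≤-∑ f (suc i) = ≤-trans (≤-∑ (f ∘ suc) i) (m≤n+m _ _)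

∑≡0⇒≡0 : (f : Fin m → ℕ) → ∑[ j < m ] f j ≡ 0 → ∀ i → f i ≡ 0
∑≡0⇒≡0 f ∑f≡0 i = n≤0⇒n≡0 (≤-trans (≤-∑ f i) (≤-reflexive ∑f≡0))

∑-single : (f : Fin m → ℕ) (a : Fin m) → (∀ i → i ≢ a → f i ≡ 0) → ∑[ i < m ] f i ≡ f a
∑-single {suc m} f zero off-a =
  trans (cong (f zero +_) (∑-zero (f ∘ suc) λ i → off-a (suc i) λ ())) (+-identityʳ (f zero))
∑-single {suc m} f (suc a) off-a =
  cong₂ _+_ (off-a zero λ ()) (∑-single (f ∘ suc) a λ i i≢a → off-a (suc i) (i≢a ∘ Fin.suc-injective))

∑-pair : (f : Fin m → ℕ) {a b : Fin m} → a ≢ b → (∀ i → i ≢ a → i ≢ b → f i ≡ 0) →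
         ∑[ i < m ] f i ≡ f a + f b
∑-pair {suc m} f {zero}  {zero}  a≢b _   = ⊥-elim (a≢b refl)
∑-pair {suc m} f {zero}  {suc b} _   off =
  cong (f zero +_) (∑-single (f ∘ suc) b λ i i≢b → off (suc i) (λ ()) (i≢b ∘ Fin.suc-injective))
∑-pair {suc m} f {suc a} {zero}  _   off =
  trans (cong (f zero +_) (∑-single (f ∘ suc) a λ i i≢a → off (suc i) (i≢a ∘ Fin.suc-injective) (λ ())))
        (+-comm (f zero) (f (suc a)))
∑-pair {suc m} f {suc a} {suc b} a≢b off =
  cong₂ _+_ (off zero (λ ()) (λ ()))
            (∑-pair (f ∘ suc) (a≢b ∘ cong suc) λ i i≢a i≢b →
               off (suc i) (i≢a ∘ Fin.suc-injective) (i≢b ∘ Fin.suc-injective))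

∑-select : (p : Fin m → Bool) (g : Fin m → ℕ) {a : Fin m} →
           p a ≡ true → (∀ i → p i ≡ true → i ≡ a) → ∑[ i < m ] (if p i then g i else 0) ≡ g a
∑-select p g {a} pa unique = trans (∑-single _ a off-a) (cong (λ b → if b then g a else 0) pa)
  where
  off-a : ∀ i → i ≢ a → (if p i then g i else 0) ≡ 0
  off-a i i≢a with p i in pi
  ... | true  = ⊥-elim (i≢a (unique i pi))
  ... | false = refl

𝟙 : Bool → ℕ
𝟙 b = if b then 1 else 0

count : (Fin m → Bool) → ℕ
count {m} p = ∑[ i < m ] 𝟙 (p i)

count-none : (p : Fin m → Bool) → (∀ i → p i ≡ false) → count p ≡ 0
count-none p none = ∑-zero _ λ i → cong 𝟙 (none i)

count-≤1 : (p : Fin m → Bool) → (∀ i j → p i ≡ true → p j ≡ true → i ≡ j) → count p ≤ 1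
count-≤1 p unique with Fin.any? (λ i → p i ≟ᵇ true)
... | yes (a , pa) = ≤-reflexive (∑-select p (λ _ → 1) pa (λ i pi → unique i a pi pa))
... | no ∄a        = subst (_≤ 1) (sym (count-none p λ i → ¬-not λ pi → ∄a (i , pi))) z≤n

count-split : (p : Fin m → Bool) (a : Fin m) →
              count p ≡ 𝟙 (p a) + count (λ i → p i ∧ not ⌊ i Fin.≟ a ⌋)
count-split {m} p a = begin
  count p                                 ≡⟨ sum-cong-≗ (λ i → split (p i) (is-a i)) ⟩
  ∑[ i < m ] (at-a i + 𝟙 (off-a i))       ≡⟨ ∑-distrib-+ at-a (𝟙 ∘ off-a) ⟩
  ∑[ i < m ] at-a i + count off-a         ≡⟨ cong (_+ count off-a) (∑-select is-a (𝟙 ∘ p) a-is-a only-a) ⟩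
  𝟙 (p a) + count off-a                   ∎
  where
  open ≡-Reasoning
  is-a off-a : Fin m → Bool
  is-a  i = ⌊ i Fin.≟ a ⌋
  off-a i = p i ∧ not (is-a i)
  at-a : Fin m → ℕ
  at-a i = if is-a i then 𝟙 (p i) else 0
  split : ∀ b q → 𝟙 b ≡ (if q then 𝟙 b else 0) + 𝟙 (b ∧ not q)
  split false false = refl
  split false true  = refl
  split true  false = refl
  split true  true  = refl
  a-is-a : is-a a ≡ true
  a-is-a with a Fin.≟ a
  ... | yes _  = refl
  ... | no a≢a = ⊥-elim (a≢a refl)
  only-a : ∀ i → is-a i ≡ true → i ≡ a
  only-a i with i Fin.≟ a
  ... | yes i≡a = λ _ → i≡a
  ... | no _    = λ ()

count≡1⇒unique : (p : Fin m → Bool) → count p ≡ 1 →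
                 ∃ λ a → p a ≡ true × (∀ i → p i ≡ true → i ≡ a)
count≡1⇒unique p count≡1 with Fin.any? (λ i → p i ≟ᵇ true)
... | no ∄a = ⊥-elim (0≢1+n (trans (sym (count-none p λ i → ¬-not λ pi → ∄a (i , pi))) count≡1))
... | yes (a , pa) = a , pa , only-a
  where
  rest : ℕ
  rest≡0 : rest ≡ 0
  rest = count (λ i → p i ∧ not ⌊ i Fin.≟ a ⌋)
  rest≡0 = +-cancelˡ-≡ 1 rest 0
    (trans (cong (λ b → 𝟙 b + rest) (sym pa)) (trans (sym (count-split p a)) count≡1))
  only-a : ∀ i → p i ≡ true → i ≡ a
  only-a i pi with i Fin.≟ a | ∑≡0⇒≡0 _ rest≡0 i
  ... | yes i≡a | _ = i≡a
  ... | no  _   | i∉rest rewrite pi = ⊥-elim (1+n≢0 i∉rest)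

∑∑-symmetric-even : (g : Fin m → Fin m → ℕ) → (∀ x y → g x y ≡ g y x) → (∀ x → g x x ≡ 0) →
                    2 ∣ ∑[ x < m ] ∑[ y < m ] g x y
∑∑-symmetric-even {zero}  g symm diag = divides 0 refl
∑∑-symmetric-even {suc m} g symm diag =
  subst (2 ∣_) (sym ∑∑g≡) (∣m∣n⇒∣m+n (subst (2 ∣_) (cong (A +_) (+-identityʳ A)) (m∣m*n A)) ∣rest)
  where
  open ≡-Reasoning
  A    = ∑[ y < m ] g zero (suc y)
  rest = ∑[ x < m ] ∑[ y < m ] g (suc x) (suc y)
  ∣rest : 2 ∣ rest
  ∣rest = ∑∑-symmetric-even (λ x y → g (suc x) (suc y)) (λ x y → symm (suc x) (suc y)) (diag ∘ suc)
  ∑∑g≡ : ∑[ x < suc m ] ∑[ y < suc m ] g x y ≡ (A + A) + rest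
  ∑∑g≡ = begin
    (g zero zero + A) + ∑[ x < m ] (g (suc x) zero + ∑[ y < m ] g (suc x) (suc y))
      ≡⟨ cong₂ _+_ (cong (_+ A) (diag zero)) (∑-distrib-+ (λ x → g (suc x) zero) _) ⟩
    A + (∑[ x < m ] g (suc x) zero + rest)
      ≡⟨ cong (λ B → A + (B + rest)) (sum-cong-≗ λ x → symm (suc x) zero) ⟩
    A + (A + rest)
      ≡⟨ +-assoc A A rest ⟨
    (A + A) + rest
      ∎

∑-complement : (f : Fin m → ℕ) → (∀ i → f i ≤ 1) → ∑[ i < m ] (1 ∸ f i) + ∑[ i < m ] f i ≡ m
∑-complement {m} f f≤1 = begin
  ∑[ i < m ] (1 ∸ f i) + ∑[ i < m ] f i  ≡⟨ ∑-distrib-+ (λ i → 1 ∸ f i) f ⟨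
  ∑[ i < m ] (1 ∸ f i + f i)             ≡⟨ sum-cong-≗ (λ i → m∸n+n≡m (f≤1 i)) ⟩
  ∑[ i < m ] 1                           ≡⟨ ∑-const m 1 ⟩
  m * 1                                  ≡⟨ *-identityʳ m ⟩
  m                                      ∎
  where open ≡-Reasoning

2∣m∧n<2⇒[m+n]%2≡n : ∀ {m n} → 2 ∣ m → n < 2 → (m + n) % 2 ≡ n
2∣m∧n<2⇒[m+n]%2≡n {m} {n} (divides q m≡q*2) n<2 = begin
  (m + n) % 2      ≡⟨ cong (λ m → (m + n) % 2) m≡q*2 ⟩
  (q * 2 + n) % 2  ≡⟨ cong (_% 2) (+-comm (q * 2) n) ⟩
  (n + q * 2) % 2  ≡⟨ [m+kn]%n≡m%n n q 2 ⟩
  n % 2            ≡⟨ m<n⇒m%n≡m n<2 ⟩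
  n                ∎
  where open ≡-Reasoning

n<2∧m*n≡2⇒m≡2 : ∀ m n → n < 2 → m * n ≡ 2 → m ≡ 2
n<2∧m*n≡2⇒m≡2 m 0 _ m*0≡2 with trans (sym (*-zeroʳ m)) m*0≡2
... | ()
n<2∧m*n≡2⇒m≡2 m 1 _ m*1≡2 = trans (sym (*-identityʳ m)) m*1≡2
n<2∧m*n≡2⇒m≡2 m (suc (suc _)) (s≤s (s≤s ())) _

count-colour : ∀ {k c} → 1 ≤ c → c ≤ k → count {k} (λ j → ⌊ c ≟ suc (toℕ j) ⌋) ≡ 1
count-colour {k} {suc i} _ c≤k = ∑-select _ (λ _ → 1) at-a only-a
  where
  a : Fin k
  a = fromℕ< c≤k
  at-a : ⌊ suc i ≟ suc (toℕ a) ⌋ ≡ true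
  at-a with suc i ≟ suc (toℕ a)
  ... | yes _  = refl
  ... | no c≢a = ⊥-elim (c≢a (cong suc (sym (Fin.toℕ-fromℕ< c≤k))))
  only-a : ∀ j → ⌊ suc i ≟ suc (toℕ j) ⌋ ≡ true → j ≡ a
  only-a j with suc i ≟ suc (toℕ j)
  ... | yes c≡j = λ _ → Fin.toℕ-injective (trans (suc-injective (sym c≡j)) (sym (Fin.toℕ-fromℕ< c≤k)))
  ... | no _    = λ ()

-- Graphs and edge colourings

module _ (G : Graph) where

  Adj-sym : ∀ {x y} → Adj G x y → Adj G y x
  Adj-sym {x} {y} xy = trans (Graph.sym G y x) xy

  Adj-irrefl : ∀ {x y} → Adj G x y → x ≢ y
  Adj-irrefl {x} xy refl with trans (sym xy) (irrefl G x)
  ... | ()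

  degree≡count : ∀ x → degree G x ≡ count (adj G x)
  degree≡count x = sum-map-allFin (λ y → 𝟙 (adj G x y))

module Proper (G : Graph) {k : ℕ} {c : EdgeCol G} (proper : ProperColoring G k c) where

  colour-sym : ∀ {x y} → Adj G x y → c x y ≡ c y x
  colour-sym {x} {y} = proj₁ proper x y

  colour-range : ∀ {x y} → Adj G x y → 1 ≤ c x y × c x y ≤ k
  colour-range {x} {y} = proj₁ (proj₂ proper) x y

  colour-distinct : ∀ {x y w} → Adj G x y → Adj G x w → y ≢ w → c x y ≢ c x w
  colour-distinct {x} {y} {w} = proj₂ (proj₂ proper) x y w

module ColourDegree (G : Graph) (c : EdgeCol G) where

  colourDegree : ℕ → Fin (n G) → ℕ
  colourDegree j x = count (λ y → adj G x y ∧ ⌊ c x y ≟ j ⌋)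

  colourDegree≡0 : ∀ {j x} → colourDegree j x ≡ 0 → ∀ y → Adj G x y → c x y ≢ j
  colourDegree≡0 {j} {x} none y xy cxy≡j with c x y ≟ j | ∑≡0⇒≡0 _ none y
  ... | yes _   | y∉ rewrite xy = 1+n≢0 y∉
  ... | no cxy≢j | _ = cxy≢j cxy≡j

  module _ {k} (proper : ProperColoring G k c) where

    open Proper G proper

    colourDegree-≤1 : ∀ j x → colourDegree j x ≤ 1
    colourDegree-≤1 j x = count-≤1 _ unique
      where
      unique : ∀ y w → (adj G x y ∧ ⌊ c x y ≟ j ⌋) ≡ true → (adj G x w ∧ ⌊ c x w ≟ j ⌋) ≡ true →
               y ≡ w
      unique y w py pw with adj G x y in xy | adj G x w in xw | c x y ≟ j | c x w ≟ j | y Fin.≟ w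
      ... | true | true | yes cxy≡j | yes cxw≡j | no y≢w =
            ⊥-elim (colour-distinct xy xw y≢w (trans cxy≡j (sym cxw≡j)))
      ... | _ | _ | _ | _ | yes y≡w = y≡w

    ∑colourDegree≡degree : ∀ x → ∑[ j < k ] colourDegree (suc (toℕ j)) x ≡ degree G x
    ∑colourDegree≡degree x = begin
      ∑[ j < k ] ∑[ y < n G ] edge-of-colour j y  ≡⟨ ∑-comm (λ j y → edge-of-colour j y) ⟩
      ∑[ y < n G ] ∑[ j < k ] edge-of-colour j y  ≡⟨ sum-cong-≗ one-colour ⟩
      count (adj G x)                             ≡⟨ degree≡count G x ⟨
      degree G x                                  ∎
      where
      open ≡-Reasoning
      edge-of-colour : Fin k → Fin (n G) → ℕ
      edge-of-colour j y = if adj G x y ∧ ⌊ c x y ≟ suc (toℕ j) ⌋ then 1 else 0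
      one-colour : ∀ y → ∑[ j < k ] edge-of-colour j y ≡ 𝟙 (adj G x y)
      one-colour y with adj G x y in xy
      ... | false = count-none {k} (λ _ → false) (λ _ → refl)
      ... | true  = count-colour (proj₁ (colour-range xy)) (proj₂ (colour-range xy))

    colourDegree-even : ∀ j → 2 ∣ ∑[ x < n G ] colourDegree j x
    colourDegree-even j = ∑∑-symmetric-even _ symmetric diagonal
      where
      symmetric : ∀ x y → 𝟙 (adj G x y ∧ ⌊ c x y ≟ j ⌋) ≡ 𝟙 (adj G y x ∧ ⌊ c y x ≟ j ⌋)
      symmetric x y rewrite Graph.sym G y x with adj G x y in xy
      ... | true  = cong (λ a → 𝟙 ⌊ a ≟ j ⌋) (colour-sym xy)
      ... | false = refl
      diagonal : ∀ x → 𝟙 (adj G x x ∧ ⌊ c x x ≟ j ⌋) ≡ 0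
      diagonal x rewrite irrefl G x = refl

    colourDegree-present : ∀ {j x y} → Adj G x y → c x y ≡ j → colourDegree j x ≡ 1
    colourDegree-present {j} {x} {y} xy cxy≡j = ∑-select _ (λ _ → 1) at-y only-y
      where
      at-y : (adj G x y ∧ ⌊ c x y ≟ j ⌋) ≡ true
      at-y rewrite xy with c x y ≟ j
      ... | yes _      = refl
      ... | no cxy≢j   = ⊥-elim (cxy≢j cxy≡j)
      only-y : ∀ w → (adj G x w ∧ ⌊ c x w ≟ j ⌋) ≡ true → w ≡ y
      only-y w pw with adj G x w in xw | c x w ≟ j | w Fin.≟ y
      ... | true | yes cxw≡j | no w≢y =
            ⊥-elim (colour-distinct xw xy w≢y (trans cxw≡j (sym cxy≡j)))
      ... | _ | _ | yes w≡y = w≡y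

-- A colouring that uses its top colour on a single edge

module SpecialEdge (G : Graph) (d : ℕ) (c : EdgeCol G) (proper : ProperColoring G (suc d) c)
  (u v : Fin (n G)) (uv : Adj G u v)
  (top⇔uv : ∀ x y → Adj G x y →
              (c x y ≡ suc d → (x ≡ u × y ≡ v) ⊎ (x ≡ v × y ≡ u)) ×
              ((x ≡ u × y ≡ v) ⊎ (x ≡ v × y ≡ u) → c x y ≡ suc d)) where

  open Proper G proper
  open ColourDegree G c

  uv-top : c u v ≡ suc d
  uv-top = proj₂ (top⇔uv u v uv) (inj₁ (refl , refl))

  top⇒uv : ∀ {x y} → Adj G x y → c x y ≡ suc d → (x ≡ u × y ≡ v) ⊎ (x ≡ v × y ≡ u)
  top⇒uv {x} {y} xy = proj₁ (top⇔uv x y xy)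

  top-end : ∀ {x y} → Adj G x y → c x y ≡ suc d → x ≡ u ⊎ x ≡ v
  top-end xy top with top⇒uv xy top
  ... | inj₁ (x≡u , _) = inj₁ x≡u
  ... | inj₂ (x≡v , _) = inj₂ x≡v

  colourDegree-top≡0 : ∀ {x} → x ≢ u → x ≢ v → colourDegree (suc d) x ≡ 0
  colourDegree-top≡0 {x} x≢u x≢v = count-none _ no-top
    where
    no-top : ∀ y → (adj G x y ∧ ⌊ c x y ≟ suc d ⌋) ≡ false
    no-top y with adj G x y in xy | c x y ≟ suc d
    ... | false | _      = refl
    ... | true  | no _   = refl
    ... | true  | yes top with top-end xy top
    ...   | inj₁ x≡u = ⊥-elim (x≢u x≡u)
    ...   | inj₂ x≡v = ⊥-elim (x≢v x≡v)

  missing : Fin d → Fin (n G) → ℕ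
  missing j x = 1 ∸ colourDegree (suc (toℕ j)) x

  ∑missing≡colourDegree-top : Regular G d → ∀ x → ∑[ j < d ] missing j x ≡ colourDegree (suc d) x
  ∑missing≡colourDegree-top regular x = +-cancelʳ-≡ present _ _ (begin
    ∑[ j < d ] missing j x + present   ≡⟨ ∑-complement {d} (λ j → colourDegree (suc (toℕ j)) x)
                                                       (λ j → colourDegree-≤1 proper _ x) ⟩
    d                                  ≡⟨ all-colours ⟨
    present + colourDegree (suc d) x   ≡⟨ +-comm present _ ⟩
    colourDegree (suc d) x + present   ∎)
    where
    open ≡-Reasoning
    present = ∑[ j < d ] colourDegree (suc (toℕ j)) x
    all-colours : present + colourDegree (suc d) x ≡ d
    all-colours = begin
      present + colourDegree (suc d) x
        ≡⟨ cong₂ _+_ (sum-cong-≗ {d} λ j → cong (λ i → colourDegree (suc i) x) (Fin.toℕ-inject₁ j))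
                     (cong (λ i → colourDegree (suc i) x) (Fin.toℕ-fromℕ d)) ⟨
      ∑[ j < d ] colourDegree (suc (toℕ (inject₁ j))) x + colourDegree (suc (toℕ (fromℕ d))) x
        ≡⟨ sum-init-last (λ j → colourDegree (suc (toℕ j)) x) ⟨
      ∑[ j < suc d ] colourDegree (suc (toℕ j)) x
        ≡⟨ ∑colourDegree≡degree proper x ⟩
      degree G x
        ≡⟨ regular x ⟩
      d ∎

  module _ (j : ℕ) (1≤j : 1 ≤ j) (j≤d : j ≤ d)
           (u-misses : ∀ t → Adj G u t → c u t ≢ j) (v-misses : ∀ t → Adj G v t → c v t ≢ j) where

    recoloured : EdgeCol G
    recoloured x y = if ⌊ c x y ≟ suc d ⌋ then j else c x y

    top-end-misses : ∀ {x y} → Adj G x y → c x y ≡ suc d → ∀ t → Adj G x t → c x t ≢ j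
    top-end-misses xy top with top-end xy top
    ... | inj₁ refl = u-misses
    ... | inj₂ refl = v-misses

    recolouring : HasProperColoring G d
    recolouring = recoloured , symmetric , range , distinct
      where
      symmetric : ∀ x y → Adj G x y → recoloured x y ≡ recoloured y x
      symmetric x y xy with c x y ≟ suc d | c y x ≟ suc d
      ... | yes _   | yes _   = refl
      ... | no _    | no _    = colour-sym xy
      ... | yes top | no ¬top = ⊥-elim (¬top (trans (sym (colour-sym xy)) top))
      ... | no ¬top | yes top = ⊥-elim (¬top (trans (colour-sym xy) top))
      range : ∀ x y → Adj G x y → 1 ≤ recoloured x y × recoloured x y ≤ d
      range x y xy with c x y ≟ suc d
      ... | yes _    = 1≤j , j≤d
      ... | no ¬top  = proj₁ (colour-range xy) , ≤-pred (≤∧≢⇒< (proj₂ (colour-range xy)) ¬top)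
      distinct : ∀ x y w → Adj G x y → Adj G x w → y ≢ w → recoloured x y ≢ recoloured x w
      distinct x y w xy xw y≢w with c x y ≟ suc d | c x w ≟ suc d
      ... | yes top   | yes top′ = ⊥-elim (colour-distinct xy xw y≢w (trans top (sym top′)))
      ... | yes top   | no _     = top-end-misses xy top w xw ∘ sym
      ... | no _      | yes top  = top-end-misses xw top y xy
      ... | no _      | no _     = colour-distinct xy xw y≢w

  top-edge-recolouring : ∀ j → 1 ≤ j → j ≤ d → ∀ {x y} → Adj G x y → c x y ≡ suc d →
                         (∀ t → Adj G x t → c x t ≢ j) → (∀ t → Adj G y t → c y t ≢ j) →
                         HasProperColoring G d
  top-edge-recolouring j 1≤j j≤d xy top x-misses y-misses with top⇒uv xy top
  ... | inj₁ (refl , refl) = recolouring j 1≤j j≤d x-misses y-misses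
  ... | inj₂ (refl , refl) = recolouring j 1≤j j≤d y-misses x-misses

  missing-at-most-one : (∀ k → HasProperColoring G k → suc d ≤ k) → ∀ j → missing j u + missing j v ≤ 1
  missing-at-most-one minimal j
    with n≤1⇒n≡0∨n≡1 (colourDegree-≤1 proper (suc (toℕ j)) u)
       | n≤1⇒n≡0∨n≡1 (colourDegree-≤1 proper (suc (toℕ j)) v)
  ... | inj₂ at-u | _ rewrite at-u = m∸n≤m 1 (colourDegree (suc (toℕ j)) v)
  ... | inj₁ _ | inj₂ at-v rewrite at-v =
        ≤-trans (≤-reflexive (+-identityʳ (missing j u))) (m∸n≤m 1 (colourDegree (suc (toℕ j)) u))
  ... | inj₁ none-u | inj₁ none-v =
        ⊥-elim (1+n≰n (minimal d (recolouring (suc (toℕ j)) (s≤s z≤n) (Fin.toℕ<n j)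
                                               (colourDegree≡0 none-u) (colourDegree≡0 none-v))))

  module _ (regular : Regular G d) (minimal : ∀ k → HasProperColoring G k → suc d ≤ k) where

    missing-off : ∀ j {x} → x ≢ u → x ≢ v → missing j x ≡ 0
    missing-off j x≢u x≢v =
      ∑≡0⇒≡0 (λ j → missing j _) (trans (∑missing≡colourDegree-top regular _) (colourDegree-top≡0 x≢u x≢v)) j

    missing≡n%2 : ∀ j → missing j u + missing j v ≡ n G % 2
    missing≡n%2 j = begin
      missing j u + missing j v
        ≡⟨ 2∣m∧n<2⇒[m+n]%2≡n (colourDegree-even proper colour) (s≤s (missing-at-most-one minimal j)) ⟨
      (present + (missing j u + missing j v)) % 2
        ≡⟨ cong (_% 2) vertex-count ⟩
      n G % 2
        ∎
      where
      open ≡-Reasoning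
      colour = suc (toℕ j)
      present absent : ℕ
      present = ∑[ x < n G ] colourDegree colour x
      absent  = ∑[ x < n G ] missing j x
      vertex-count : present + (missing j u + missing j v) ≡ n G
      vertex-count = begin
        present + (missing j u + missing j v)
          ≡⟨ cong (present +_) (∑-pair (missing j) (Adj-irrefl G uv) (λ x → missing-off j)) ⟨
        present + absent
          ≡⟨ +-comm present absent ⟩
        absent + present
          ≡⟨ ∑-complement (colourDegree colour) (colourDegree-≤1 proper colour) ⟩
        n G ∎

    degree≡2 : d ≡ 2
    degree≡2 = n<2∧m*n≡2⇒m≡2 d (n G % 2) (m%n<n (n G) 2) (begin
      d * (n G % 2)                                  ≡⟨ ∑-const d (n G % 2) ⟨
      ∑[ j < d ] (n G % 2)                           ≡⟨ sum-cong-≗ missing≡n%2 ⟨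
      ∑[ j < d ] (missing j u + missing j v)         ≡⟨ ∑-distrib-+ (λ j → missing j u) (λ j → missing j v) ⟩
      ∑[ j < d ] missing j u + ∑[ j < d ] missing j v
        ≡⟨ cong₂ _+_ (∑missing≡colourDegree-top regular u) (∑missing≡colourDegree-top regular v) ⟩
      colourDegree (suc d) u + colourDegree (suc d) v
        ≡⟨ cong₂ _+_ (colourDegree-present proper uv uv-top)
                     (colourDegree-present proper (Adj-sym G uv) (trans (sym (colour-sym uv)) uv-top)) ⟩
      2                                              ∎)
      where open ≡-Reasoning

-- 2-regular graphs

module TwoRegular (G : Graph) (regular : Regular G 2) where

  other-neighbour : ∀ {x y} → Adj G x y →
                    ∃ λ w → Adj G x w × w ≢ y × (∀ t → Adj G x t → t ≡ y ⊎ t ≡ w)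
  other-neighbour {x} {y} xy with count≡1⇒unique others (+-cancelˡ-≡ 1 (count others) 1 (begin
      1 + count others                                ≡⟨ cong (λ b → 𝟙 b + count others) xy ⟨
      𝟙 (adj G x y) + count others     ≡⟨ count-split (adj G x) y ⟨
      count (adj G x)                                 ≡⟨ degree≡count G x ⟨
      degree G x                                      ≡⟨ regular x ⟩
      2                                               ∎))
    where
    open ≡-Reasoning
    others = λ t → adj G x t ∧ not ⌊ t Fin.≟ y ⌋
  ... | w , w-other , only-w = w , proj₁ (other w w-other) , proj₂ (other w w-other) , neighbours
    where
    other : ∀ t → (adj G x t ∧ not ⌊ t Fin.≟ y ⌋) ≡ true → Adj G x t × t ≢ y
    other t _ with adj G x t | t Fin.≟ y
    ... | true | no t≢y = refl , t≢y
    neighbours : ∀ t → Adj G x t → t ≡ y ⊎ t ≡ w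
    neighbours t xt with t Fin.≟ y in t≟y
    ... | yes t≡y = inj₁ t≡y
    ... | no _    = inj₂ (only-w t (cong₂ (λ a b → a ∧ not ⌊ b ⌋) xt t≟y))

  neighbours : ∀ {x y w} → Adj G x y → Adj G x w → y ≢ w → ∀ t → Adj G x t → t ≡ y ⊎ t ≡ w
  neighbours xy xw y≢w t xt with other-neighbour xy
  ... | w′ , _ , _ , only-y-w′ with only-y-w′ _ xw | only-y-w′ t xt
  ...   | inj₁ w≡y  | _          = ⊥-elim (y≢w (sym w≡y))
  ...   | inj₂ _    | inj₁ t≡y   = inj₁ t≡y
  ...   | inj₂ w≡w′ | inj₂ t≡w′  = inj₂ (trans t≡w′ (sym w≡w′))

  partialSum≡ : ∀ (col : EdgeCol G) {x y w} → Adj G x y → Adj G x w → y ≢ w →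
                partialSum G col x y ≡ col x w
  partialSum≡ col {x} {y} {w} xy xw y≢w =
    trans (sum-map-allFin (λ t → if adj G x t ∧ not ⌊ t Fin.≟ y ⌋ then col x t else 0))
          (∑-select (λ t → adj G x t ∧ not ⌊ t Fin.≟ y ⌋) (col x) at-w only-w)
    where
    at-w : (adj G x w ∧ not ⌊ w Fin.≟ y ⌋) ≡ true
    at-w rewrite xw with w Fin.≟ y
    ... | yes w≡y = ⊥-elim (y≢w (sym w≡y))
    ... | no _    = refl
    only-w : ∀ t → (adj G x t ∧ not ⌊ t Fin.≟ y ⌋) ≡ true → t ≡ w
    only-w t _ with adj G x t in xt | t Fin.≟ y
    ... | true | no t≢y with neighbours xy xw y≢w t xt
    ...   | inj₁ t≡y = ⊥-elim (t≢y t≡y)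
    ...   | inj₂ t≡w = t≡w

  nbSum≡ : ∀ (col : EdgeCol G) {x y w y′} → Adj G x y → Adj G x w → y ≢ w → Adj G y y′ → y′ ≢ x →
           nbSum G col x y ≡ col x w + col y y′
  nbSum≡ col xy xw y≢w yy′ y′≢x =
    cong₂ _+_ (partialSum≡ col xy xw y≢w) (partialSum≡ col (Adj-sym G xy) yy′ (y′≢x ∘ sym))

-- The rebalanced 3-edge-colouring

rebalance : ℕ → Bool → ℕ
rebalance 3 _    = 2
rebalance 2 true = 3
rebalance k _    = k

rebalance-range : ∀ {k} b → 1 ≤ k × k ≤ 3 → 1 ≤ rebalance k b × rebalance k b ≤ 3
rebalance-range {1}     _     _ = s≤s z≤n , s≤s z≤n
rebalance-range {2}     false _ = s≤s z≤n , s≤s (s≤s z≤n)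
rebalance-range {2}     true  _ = s≤s z≤n , ≤-refl
rebalance-range {3}     _     _ = s≤s z≤n , s≤s (s≤s z≤n)
rebalance-range {suc (suc (suc (suc _)))} _ (_ , s≤s (s≤s (s≤s ())))

≢-by-values : ∀ {p q a b : ℕ} → p ≡ a → q ≡ b → a ≢ b → p ≢ q
≢-by-values refl refl a≢b = a≢b

light≢heavy : ∀ {a b p q} → a ≡ 1 → b ≡ 1 → 2 ≤ p → 2 ≤ q → a + b ≢ p + q
light≢heavy refl refl 2≤p 2≤q = <⇒≢ (≤-trans (s≤s (s≤s (s≤s z≤n))) (+-mono-≤ 2≤p 2≤q))

module Rebalanced (G : Graph) (regular : Regular G 2) (c : EdgeCol G) (proper : ProperColoring G 3 c)
  (u v : Fin (n G)) (uv : Adj G u v)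
  (top⇔uv : ∀ x y → Adj G x y →
              (c x y ≡ 3 → (x ≡ u × y ≡ v) ⊎ (x ≡ v × y ≡ u)) ×
              ((x ≡ u × y ≡ v) ⊎ (x ≡ v × y ≡ u) → c x y ≡ 3))
  (no-triangle : NotInTriangle G u v) (minimal : ∀ k → HasProperColoring G k → 3 ≤ k) where

  open Proper G proper
  open TwoRegular G regular
  open SpecialEdge G 2 c proper u v uv top⇔uv using (top⇒uv; top-end; top-edge-recolouring)

  colour-cases : ∀ {x y} → Adj G x y → c x y ≡ 1 ⊎ c x y ≡ 2 ⊎ c x y ≡ 3
  colour-cases {x} {y} xy with c x y | colour-range xy
  ... | 1 | _ = inj₁ refl
  ... | 2 | _ = inj₂ (inj₁ refl)
  ... | 3 | _ = inj₂ (inj₂ refl)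
  ... | suc (suc (suc (suc _))) | _ , s≤s (s≤s (s≤s ()))

  non-top : ∀ {x y} → Adj G x y → c x y ≢ 3 → c x y ≡ 1 ⊎ c x y ≡ 2
  non-top xy ¬top with colour-cases xy
  ... | inj₁ ≡1        = inj₁ ≡1
  ... | inj₂ (inj₁ ≡2) = inj₂ ≡2
  ... | inj₂ (inj₂ ≡3) = ⊥-elim (¬top ≡3)

  -- u and v are themselves near, being adjacent.
  near : Fin (n G) → Bool
  near z = adj G z u ∨ adj G z v

  near-end : ∀ {z p} → Adj G z p → p ≡ u ⊎ p ≡ v → near z ≡ true
  near-end {z} zu (inj₁ refl) = cong (_∨ adj G z v) zu
  near-end {z} zv (inj₂ refl) = trans (∨-comm (adj G z u) _) (cong (_∨ adj G z u) zv)

  near-top : ∀ {x y} → Adj G x y → c x y ≡ 3 → near x ≡ true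
  near-top xy top = near-end xy (top-end (Adj-sym G xy) (trans (sym (colour-sym xy)) top))

  near-top-end : ∀ {x y z} → Adj G x y → c x y ≡ 3 → Adj G z x → near z ≡ true
  near-top-end xy top zx = near-end zx (top-end xy top)

  c₂ : EdgeCol G
  c₂ x y = rebalance (c x y) (near x ∨ near y)

  c₂-sym : ∀ {x y} → Adj G x y → c₂ x y ≡ c₂ y x
  c₂-sym {x} {y} xy = cong₂ rebalance (colour-sym xy) (∨-comm (near x) (near y))

  c₂-light : ∀ {x y} → c x y ≡ 1 → c₂ x y ≡ 1
  c₂-light {x} {y} ≡1 = cong (λ k → rebalance k (near x ∨ near y)) ≡1

  c₂-top : ∀ {x y} → c x y ≡ 3 → c₂ x y ≡ 2
  c₂-top {x} {y} ≡3 = cong (λ k → rebalance k (near x ∨ near y)) ≡3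

  c₂-near : ∀ {x y} → c x y ≡ 2 → near x ≡ true → c₂ x y ≡ 3
  c₂-near {x} {y} ≡2 near-x = cong₂ rebalance ≡2 (cong (_∨ near y) near-x)

  c₂-two : ∀ {x y} → c x y ≡ 2 → c₂ x y ≡ 2 ⊎ c₂ x y ≡ 3
  c₂-two {x} {y} ≡2 rewrite ≡2 with near x ∨ near y
  ... | false = inj₁ refl
  ... | true  = inj₂ refl

  c₂-≥2 : ∀ {x y} → c x y ≡ 2 → 2 ≤ c₂ x y
  c₂-≥2 ≡2 with c₂-two ≡2
  ... | inj₁ ≡2′ = ≤-reflexive (sym ≡2′)
  ... | inj₂ ≡3′ = ≤-trans (n≤1+n 2) (≤-reflexive (sym ≡3′))

  c₂-heavy : ∀ {x y} → Adj G x y → c x y ≢ 1 → 2 ≤ c₂ x y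
  c₂-heavy xy ≢1 with colour-cases xy
  ... | inj₁ ≡1        = ⊥-elim (≢1 ≡1)
  ... | inj₂ (inj₁ ≡2) = c₂-≥2 ≡2
  ... | inj₂ (inj₂ ≡3) = ≤-reflexive (sym (c₂-top ≡3))

  c₂-proper : ProperColoring G 3 c₂
  c₂-proper = (λ x y → c₂-sym) , (λ x y xy → rebalance-range _ (colour-range xy)) , distinct
    where
    ≢-light : ∀ {x y w} → Adj G x w → c x y ≡ 1 → c x w ≢ 1 → c₂ x y ≢ c₂ x w
    ≢-light xw ≡1 ≢1 eq = 1+n≰n (≤-trans (c₂-heavy xw ≢1) (≤-reflexive (trans (sym eq) (c₂-light ≡1))))
    distinct : ∀ x y w → Adj G x y → Adj G x w → y ≢ w → c₂ x y ≢ c₂ x w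
    distinct x y w xy xw y≢w with colour-cases xy | colour-cases xw
    ... | inj₁ ≡1 | _ = ≢-light xw ≡1 (colour-distinct xy xw y≢w ∘ trans ≡1 ∘ sym)
    ... | _ | inj₁ ≡1 = ≢-light xy ≡1 (colour-distinct xw xy (y≢w ∘ sym) ∘ trans ≡1 ∘ sym) ∘ sym
    ... | inj₂ (inj₁ ≡2) | inj₂ (inj₂ ≡3) = ≢-by-values (c₂-near ≡2 (near-top xw ≡3)) (c₂-top ≡3) λ ()
    ... | inj₂ (inj₂ ≡3) | inj₂ (inj₁ ≡2) = ≢-by-values (c₂-top ≡3) (c₂-near ≡2 (near-top xy ≡3)) λ ()
    ... | inj₂ (inj₁ ≡2) | inj₂ (inj₁ ≡2′) = ⊥-elim (colour-distinct xy xw y≢w (trans ≡2 (sym ≡2′)))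
    ... | inj₂ (inj₂ ≡3) | inj₂ (inj₂ ≡3′) = ⊥-elim (colour-distinct xy xw y≢w (trans ≡3 (sym ≡3′)))

  top-unique-end : ∀ {x y p q} → Adj G x y → c x y ≡ 3 → Adj G p q → c p q ≡ 3 → p ≡ x ⊎ p ≡ y
  top-unique-end xy top pq top′ with top⇒uv xy top | top-end pq top′
  ... | inj₁ (refl , refl) | inj₁ refl = inj₁ refl
  ... | inj₁ (refl , refl) | inj₂ refl = inj₂ refl
  ... | inj₂ (refl , refl) | inj₁ refl = inj₂ refl
  ... | inj₂ (refl , refl) | inj₂ refl = inj₁ refl

  top-no-common-neighbour : ∀ {x p q} → Adj G p q → c p q ≡ 3 → Adj G x p → Adj G x q → ⊥
  top-no-common-neighbour {x} pq top xp xq with top⇒uv pq top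
  ... | inj₁ (refl , refl) = no-triangle x (Adj-sym G xp , Adj-sym G xq)
  ... | inj₂ (refl , refl) = no-triangle x (Adj-sym G xq , Adj-sym G xp)

  sees-only : ∀ {x p q j} → Adj G x p → Adj G x q → p ≢ q → c x p ≢ j → c x q ≢ j →
              ∀ t → Adj G x t → c x t ≢ j
  sees-only xp xq p≢q p≢j q≢j t xt with neighbours xp xq p≢q t xt
  ... | inj₁ refl = p≢j
  ... | inj₂ refl = q≢j

  -- The path y′ y x w w′. In a 2-regular graph N′(xy) = {xw, yy′} and N′(xw) = {xy, ww′}.
  record Window : Set where
    field
      x y w y′ w′ : Fin (n G)
      xy   : Adj G x y
      xw   : Adj G x w
      y≢w  : y ≢ w
      yy′  : Adj G y y′
      y′≢x : y′ ≢ x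
      ww′  : Adj G w w′
      w′≢x : w′ ≢ x

  Balanced : Window → Set
  Balanced P = c₂ x w + c₂ y y′ ≢ c₂ x y + c₂ w w′
    where open Window P

  mirror : Window → Window
  mirror P = record { x = x ; y = w ; w = y ; y′ = w′ ; w′ = y′ ; xy = xw ; xw = xy ; y≢w = y≢w ∘ sym
                    ; yy′ = ww′ ; y′≢x = w′≢x ; ww′ = yy′ ; w′≢x = y′≢x }
    where open Window P

  balanced-mirror : ∀ P → Balanced (mirror P) → Balanced P
  balanced-mirror P balanced = balanced ∘ sym

  module _ (P : Window) where
    open Window P

    at-x : c x y ≢ c x w
    at-x = colour-distinct xy xw y≢w

    at-y : c x y ≢ c y y′
    at-y = colour-distinct (Adj-sym G xy) yy′ (y′≢x ∘ sym) ∘ trans (sym (colour-sym xy))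

    at-w : c x w ≢ c w w′
    at-w = colour-distinct (Adj-sym G xw) ww′ (w′≢x ∘ sym) ∘ trans (sym (colour-sym xw))

    -- Otherwise the colour of {1, 2} missing at both ends of the top edge could be moved onto it.
    top-neighbours-differ : c x y ≡ 3 → c x w ≢ c y y′
    top-neighbours-differ top same =
      [ (λ ≡1 → recolourable 2 (s≤s z≤n) ≤-refl (≢-by-values ≡1 refl λ ()))
      , (λ ≡2 → recolourable 1 ≤-refl (s≤s z≤n) (≢-by-values ≡2 refl λ ()))
      ]′ (non-top xw (at-x ∘ trans top ∘ sym))
      where
      recolourable : ∀ j → 1 ≤ j → j ≤ 2 → c x w ≢ j → ⊥
      recolourable j 1≤j j≤2 xw≢j = 1+n≰n (minimal 2 (top-edge-recolouring j 1≤j j≤2 xy top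
        (sees-only xy xw y≢w (j≢3 ∘ trans (sym top)) xw≢j)
        (sees-only (Adj-sym G xy) yy′ (y′≢x ∘ sym) (j≢3 ∘ trans (sym top) ∘ trans (colour-sym xy))
                   (xw≢j ∘ trans same))))
        where
        j≢3 : 3 ≢ j
        j≢3 = ≢-sym (<⇒≢ (s≤s j≤2))

    top-middle-far : c x y ≡ 3 → c w w′ ≢ 3
    top-middle-far top top′ with top-unique-end xy top ww′ top′
    ... | inj₁ w≡x = Adj-irrefl G xw (sym w≡x)
    ... | inj₂ w≡y = y≢w (sym w≡y)

    balanced-top-middle : c x y ≡ 3 → Balanced P
    balanced-top-middle top with non-top xw (at-x ∘ trans top ∘ sym) | non-top yy′ (at-y ∘ trans top ∘ sym)
                               | non-top ww′ (top-middle-far top)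
    ... | inj₁ ≡1 | inj₁ ≡1′ | _        = ⊥-elim (top-neighbours-differ top (trans ≡1 (sym ≡1′)))
    ... | inj₂ ≡2 | inj₂ ≡2′ | _        = ⊥-elim (top-neighbours-differ top (trans ≡2 (sym ≡2′)))
    ... | inj₁ ≡1 | _        | inj₁ ≡1′ = ⊥-elim (at-w (trans ≡1 (sym ≡1′)))
    ... | inj₂ ≡2 | _        | inj₂ ≡2′ = ⊥-elim (at-w (trans ≡2 (sym ≡2′)))
    ... | inj₁ xw≡1 | inj₂ yy′≡2 | inj₂ ww′≡2 =
          ≢-by-values (cong₂ _+_ (c₂-light xw≡1) (c₂-near yy′≡2 (near-top-end xy top (Adj-sym G xy))))
                      (cong₂ _+_ (c₂-top top) (c₂-near ww′≡2 (near-top-end xy top (Adj-sym G xw)))) λ ()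
    ... | inj₂ xw≡2 | inj₁ yy′≡1 | inj₁ ww′≡1 =
          ≢-by-values (cong₂ _+_ (c₂-near xw≡2 (near-top xy top)) (c₂-light yy′≡1))
                      (cong₂ _+_ (c₂-top top) (c₂-light ww′≡1)) λ ()

    top-far-far : c y y′ ≡ 3 → c w w′ ≢ 3
    top-far-far top top′ with top-unique-end yy′ top ww′ top′
    ... | inj₁ w≡y  = y≢w (sym w≡y)
    ... | inj₂ refl = top-no-common-neighbour yy′ top xy xw

    balanced-top-far : c x y ≢ 3 → c x w ≢ 3 → c y y′ ≡ 3 → Balanced P
    balanced-top-far xy≢3 xw≢3 top with non-top xy xy≢3 | non-top xw xw≢3 | non-top ww′ (top-far-far top)
    ... | inj₁ ≡1 | inj₁ ≡1′ | _        = ⊥-elim (at-x (trans ≡1 (sym ≡1′)))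
    ... | inj₂ ≡2 | inj₂ ≡2′ | _        = ⊥-elim (at-x (trans ≡2 (sym ≡2′)))
    ... | _       | inj₁ ≡1  | inj₁ ≡1′ = ⊥-elim (at-w (trans ≡1 (sym ≡1′)))
    ... | _       | inj₂ ≡2  | inj₂ ≡2′ = ⊥-elim (at-w (trans ≡2 (sym ≡2′)))
    ... | inj₁ xy≡1 | inj₂ xw≡2 | inj₁ ww′≡1 =
          ≢-by-values (cong₂ _+_ (c₂-near xw≡2 near-x) (c₂-top top))
                      (cong₂ _+_ (c₂-light xy≡1) (c₂-light ww′≡1)) λ ()
      where near-x = near-top-end yy′ top xy
    ... | inj₂ xy≡2 | inj₁ xw≡1 | inj₂ ww′≡2 with c₂-two ww′≡2
    ...   | inj₁ ww′↦2 = ≢-by-values (cong₂ _+_ (c₂-light xw≡1) (c₂-top top))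
                                    (cong₂ _+_ (c₂-near xy≡2 (near-top-end yy′ top xy)) ww′↦2) λ ()
    ...   | inj₂ ww′↦3 = ≢-by-values (cong₂ _+_ (c₂-light xw≡1) (c₂-top top))
                                    (cong₂ _+_ (c₂-near xy≡2 (near-top-end yy′ top xy)) ww′↦3) λ ()

    balanced-plain : c x y ≢ 3 → c x w ≢ 3 → c y y′ ≢ 3 → c w w′ ≢ 3 → Balanced P
    balanced-plain xy≢3 xw≢3 yy′≢3 ww′≢3
      with non-top xy xy≢3 | non-top xw xw≢3 | non-top yy′ yy′≢3 | non-top ww′ ww′≢3
    ... | inj₁ ≡1 | inj₁ ≡1′ | _        | _        = ⊥-elim (at-x (trans ≡1 (sym ≡1′)))
    ... | inj₂ ≡2 | inj₂ ≡2′ | _        | _        = ⊥-elim (at-x (trans ≡2 (sym ≡2′)))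
    ... | inj₁ ≡1 | _        | inj₁ ≡1′ | _        = ⊥-elim (at-y (trans ≡1 (sym ≡1′)))
    ... | inj₂ ≡2 | _        | inj₂ ≡2′ | _        = ⊥-elim (at-y (trans ≡2 (sym ≡2′)))
    ... | _       | inj₁ ≡1  | _        | inj₁ ≡1′ = ⊥-elim (at-w (trans ≡1 (sym ≡1′)))
    ... | _       | inj₂ ≡2  | _        | inj₂ ≡2′ = ⊥-elim (at-w (trans ≡2 (sym ≡2′)))
    ... | inj₁ xy≡1 | inj₂ xw≡2 | inj₂ yy′≡2 | inj₁ ww′≡1 =
          light≢heavy (c₂-light xy≡1) (c₂-light ww′≡1) (c₂-≥2 xw≡2) (c₂-≥2 yy′≡2) ∘ sym
    ... | inj₂ xy≡2 | inj₁ xw≡1 | inj₁ yy′≡1 | inj₂ ww′≡2 =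
          light≢heavy (c₂-light xw≡1) (c₂-light yy′≡1) (c₂-≥2 xy≡2) (c₂-≥2 ww′≡2)

  balanced : ∀ P → Balanced P
  balanced P with c x y ≟ 3 | c x w ≟ 3 | c y y′ ≟ 3 | c w w′ ≟ 3
    where open Window P
  ... | yes top | _       | _       | _       = balanced-top-middle P top
  ... | no _    | yes top | _       | _       = balanced-mirror P (balanced-top-middle (mirror P) top)
  ... | no xy≢3 | no xw≢3 | yes top | _       = balanced-top-far P xy≢3 xw≢3 top
  ... | no xy≢3 | no xw≢3 | no _    | yes top =
        balanced-mirror P (balanced-top-far (mirror P) xw≢3 xy≢3 top)
  ... | no xy≢3 | no xw≢3 | no yy′≢3 | no ww′≢3 = balanced-plain P xy≢3 xw≢3 yy′≢3 ww′≢3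

  c₂-nsd : ∀ x y w → Adj G x y → Adj G x w → y ≢ w → nbSum G c₂ x y ≢ nbSum G c₂ x w
  c₂-nsd x y w xy xw y≢w with other-neighbour (Adj-sym G xy) | other-neighbour (Adj-sym G xw)
  ... | y′ , yy′ , y′≢x , _ | w′ , ww′ , w′≢x , _ =
    ≢-by-values (nbSum≡ c₂ xy xw y≢w yy′ y′≢x) (nbSum≡ c₂ xw xy (y≢w ∘ sym) ww′ w′≢x)
      (balanced (record { x = x ; y = y ; w = w ; y′ = y′ ; w′ = w′ ; xy = xy ; xw = xw ; y≢w = y≢w
                        ; yy′ = yy′ ; y′≢x = y′≢x ; ww′ = ww′ ; w′≢x = w′≢x }))

  η′≡3 : IsEtaP G 3
  η′≡3 = (c₂ , c₂-proper , c₂-nsd) , λ k (col , proper′ , _) → minimal k (col , proper′)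

proposition2p11 : (G : Graph) (d : ℕ) →
    VizingClass2 G d →
    IsResistance G d 1 →
    (Σ (EdgeCol G) λ c → ProperColoring G (suc d) c ×
      (Σ (Fin (n G)) λ u → Σ (Fin (n G)) λ v → Adj G u v × NotInTriangle G u v ×
        (∀ x y → Adj G x y →
          (c x y ≡ suc d → (x ≡ u × y ≡ v) ⊎ (x ≡ v × y ≡ u)) ×
          ((x ≡ u × y ≡ v) ⊎ (x ≡ v × y ≡ u) → c x y ≡ suc d)))) →
    ∃[ k ] (IsEtaP G k × k ≤ 2 * d)
proposition2p11 G d (regular , _ , minimal) _ (c , proper , u , v , uv , no-triangle , top⇔uv)
  with SpecialEdge.degree≡2 G d c proper u v uv top⇔uv regular minimal
... | refl = 3 , Rebalanced.η′≡3 G regular c proper u v uv top⇔uv no-triangle minimal , n≤1+n 3
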